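{- Let $n \geq 0$ be an integer, let $X$ be a finite set and $A_1, \ldots, A_n$ nonempty finite sets, and for each $1 \leq i \leq n$ let $f_i : X \to A_i$ be a function. Then $$\# \{ (x_0, \ldots, x_n) \in X^{n+1} : f_i(x_{i-1}) = f_i(x_i) \text{ for all } 1 \leq i \leq n \} \geq \frac{(\# X)^{n+1}}{\prod_{i=1}^n \# A_i}.$$
   Context: $\# S$ denotes the cardinality of a finite set $S$; an empty product equals $1$. -}

module Defs where

open import Data.Nat using (ℕ; zero; suc; _*_)
open import Data.Fin using (Fin; zero; suc; inject₁)
open import Data.Fin.Properties using (all?) renaming (_≟_ to _≟ᶠ_)
open import Data.Vec using (Vec; []; _∷_; lookup)
open import Data.List using (List; []; _∷_; map; concatMap; length; filter)
import Level
open import Relation.Binary.PropositionalEquality using (_≡_)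
open import Relation.Unary using (Pred; Decidable)

allFinL : (m : ℕ) → List (Fin m)
allFinL zero = []
allFinL (suc m) = zero ∷ map suc (allFinL m)

allTuples : (k m : ℕ) → List (Vec (Fin m) k)
allTuples zero m = [] ∷ []
allTuples (suc k) m = concatMap (λ x → map (x ∷_) (allTuples k m)) (allFinL m)

countTuples : (k m : ℕ) {P : Pred (Vec (Fin m) k) Level.zero} → Decidable P → ℕ
countTuples k m P? = length (filter P? (allTuples k m))

prodFin : (n : ℕ) → (Fin n → ℕ) → ℕ
prodFin zero a = 1
prodFin (suc n) a = a zero * prodFin n (λ i → a (suc i))

-- The chain condition: for all 1 ≤ i ≤ n (encoded as i : Fin n),
-- f_i(x_{i-1}) = f_i(x_i).
Chain : (n m : ℕ) (a : Fin n → ℕ) (f : (i : Fin n) → Fin m → Fin (a i))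
        → Vec (Fin m) (suc n) → Set
Chain n m a f xs = ∀ (i : Fin n) → f i (lookup xs (inject₁ i)) ≡ f i (lookup xs (suc i))

chain? : (n m : ℕ) (a : Fin n → ℕ) (f : (i : Fin n) → Fin m → Fin (a i))
         → Decidable (Chain n m a f)
chain? n m a f xs = all? (λ i → f i (lookup xs (inject₁ i)) ≟ᶠ f i (lookup xs (suc i)))

chainCount : (n m : ℕ) (a : Fin n → ℕ) (f : (i : Fin n) → Fin m → Fin (a i)) → ℕ
chainCount n m a f = countTuples (suc n) m (chain? n m a f)

{-# OPTIONS --safe #-}
-- Let c(x) count the admissible tuples with x₀ = x, so the total is ∑ₓ c(x); c(x) is the mass, on
-- the fibre of f₁ through x, of the analogous count c′ for f₂, …, fₙ. The ratios c′(x) / c(x) sum to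
-- the number of nonempty fibres of f₁, at most #A₁, so AM-GM gives ∏ₓ c′(x) / c(x) ≤ (#A₁ / #X)^#X:
-- the geometric mean of c is at least #X / #A₁ times that of c′. By induction it is at least
-- #Xⁿ / ∏ᵢ #Aᵢ, and a final AM-GM bounds ∑ₓ c(x) below by #X times it. To stay in ℕ every
-- inequality is raised to the power #X.
module Submission where

open import Data.Bool using (true; false; if_then_else_)
open import Data.Bool.Properties using (if-float)
open import Data.Fin using (Fin; zero; suc)
open import Data.Fin.Properties using (_≟_)
open import Data.List using (List; []; _∷_; _++_; map; concatMap; length; filter)
open import Data.List.Properties using (filter-++; length-++; concatMap-map; filter-≐; filter-none)
import Data.List.Relation.Unary.All as All
open import Data.Nat using (ℕ; zero; suc; _+_; _*_; _^_; _⊔_; _≤_; _<_; _>_; NonZero; >-nonZero; z≤n; s≤s)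
open import Data.Nat.Properties hiding (_≟_)
open import Data.Nat.Tactic.RingSolver using (solve-∀)
open import Data.Product using (_,_)
open import Data.Sum using (inj₁; inj₂)
open import Data.Vec using (_∷_)
open import Function using (_∘_)
open import Level using (0ℓ)
open import Relation.Binary.PropositionalEquality
open import Relation.Nullary using (does; yes; no; contradiction)
open import Relation.Unary using (Pred; Decidable)

import Algebra.Properties.CommutativeMonoid.Sum as MonoidSum
import Algebra.Properties.Semiring.Sum as SemiringSum

open import Defs

open SemiringSum +-*-semiring
  using (sum; sum-syntax; sum-cong-≗; sum-replicate-zero; ∑-comm; *-distribʳ-sum)
open MonoidSum *-1-commutativeMonoid
  using () renaming (sum to product; sum-cong-≗ to product-cong-≗; ∑-distrib-+ to product-distrib-*)

^-distrib-* : ∀ x y n → (x * y) ^ n ≡ x ^ n * y ^ n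
^-distrib-* x y zero    = refl
^-distrib-* x y (suc n) = begin
  x * y * (x * y) ^ n       ≡⟨ cong (x * y *_) (^-distrib-* x y n) ⟩
  x * y * (x ^ n * y ^ n)   ≡⟨ interchange x y (x ^ n) (y ^ n) ⟩
  x * x ^ n * (y * y ^ n)   ∎
  where
  open ≡-Reasoning
  interchange : ∀ a b c d → a * b * (c * d) ≡ a * c * (b * d)
  interchange = solve-∀

2mn≤m²+n² : ∀ m n → 2 * (m * n) ≤ m * m + n * n
2mn≤m²+n² m n with ≤-total m n
... | inj₁ m≤n with d , refl ← m≤n⇒∃[o]m+o≡n m≤n =
  ≤-trans (m≤m+n _ (d * d)) (≤-reflexive (square m d))
  where
  square : ∀ m d → 2 * (m * (m + d)) + d * d ≡ m * m + (m + d) * (m + d)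
  square = solve-∀
... | inj₂ n≤m with d , refl ← m≤n⇒∃[o]m+o≡n n≤m =
  ≤-trans (m≤m+n _ (d * d)) (≤-reflexive (square n d))
  where
  square : ∀ n d → 2 * ((n + d) * n) + d * d ≡ (n + d) * (n + d) + n * n
  square = solve-∀

power-above-tangent : ∀ n x y → suc n * (x ^ n * y) ≤ y ^ suc n + n * x ^ suc n
power-above-tangent zero x y = ≤-reflexive (base x y)
  where
  base : ∀ x y → 1 * (1 * y) ≡ y * 1 + 0 * (x * 1)
  base = solve-∀
-- y · (induction hypothesis) plus (n+1)xⁿ · (2xy ≤ x² + y²) is the claim with `surplus` added to both sides.
power-above-tangent (suc n) x y = +-cancelʳ-≤ surplus _ _ (begin
    suc (suc n) * (x ^ suc n * y) + surplus
  ≡⟨ lhs n x y (x ^ n) ⟩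
    suc n * (x ^ n * y) * y + suc n * x ^ n * (2 * (x * y))
  ≤⟨ +-mono-≤ (*-monoˡ-≤ y (power-above-tangent n x y)) (*-monoʳ-≤ (suc n * x ^ n) (2mn≤m²+n² x y)) ⟩
    (y ^ suc n + n * x ^ suc n) * y + suc n * x ^ n * (x * x + y * y)
  ≡⟨ rhs n x y (x ^ n) (y ^ n) ⟩
    y ^ suc (suc n) + suc n * x ^ suc (suc n) + surplus
  ∎)
  where
  open ≤-Reasoning
  surplus = suc n * x ^ n * (y * y) + n * (x ^ suc n * y)
  lhs : ∀ n x y X → (2 + n) * (x * X * y) + ((1 + n) * X * (y * y) + n * (x * X * y))
                  ≡ (1 + n) * (X * y) * y + (1 + n) * X * (2 * (x * y))
  lhs = solve-∀
  rhs : ∀ n x y X Y → (y * Y + n * (x * X)) * y + (1 + n) * X * (x * x + y * y)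
                    ≡ y * (y * Y) + (1 + n) * (x * (x * X)) + ((1 + n) * X * (y * y) + n * (x * X * y))
  rhs = solve-∀

-- Weighted AM-GM for y and k copies of S/k: with p = (k+1)S and q = k(y+S) it is the
-- tangent-line bound for t ↦ t^(k+1) at p, evaluated at q.
amgm-step : ∀ k y S → suc k ^ suc k * (y * S ^ k) ≤ k ^ k * (y + S) ^ suc k
amgm-step zero y S = begin
    1 * (y * 1)       ≡⟨ *-identityˡ (y * 1) ⟩
    y * 1             ≡⟨ *-identityʳ y ⟩
    y                 ≤⟨ m≤m+n y S ⟩
    y + S             ≡⟨ *-identityʳ (y + S) ⟨
    (y + S) * 1       ≡⟨ *-identityˡ ((y + S) * 1) ⟨
    1 * ((y + S) * 1) ∎
  where open ≤-Reasoning
amgm-step k@(suc _) y S = *-cancelˡ-≤ k (+-cancelʳ-≤ (k * p ^ suc k) _ _ (begin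
    k * (suc k ^ suc k * (y * S ^ k)) + k * p ^ suc k
  ≡⟨ cong (λ pᵏ → k * (suc k ^ suc k * (y * S ^ k)) + k * (p * pᵏ)) (^-distrib-* (suc k) S k) ⟩
    k * (suc k ^ suc k * (y * S ^ k)) + k * (p * (suc k ^ k * S ^ k))
  ≡⟨ tangent-form k y S (suc k ^ k) (S ^ k) ⟩
    suc k * ((suc k ^ k * S ^ k) * q)
  ≡⟨ cong (λ pᵏ → suc k * (pᵏ * q)) (^-distrib-* (suc k) S k) ⟨
    suc k * (p ^ k * q)
  ≤⟨ power-above-tangent k p q ⟩
    q ^ suc k + k * p ^ suc k
  ≡⟨ cong (_+ k * p ^ suc k) (trans (^-distrib-* k (y + S) (suc k)) (*-assoc k (k ^ k) _)) ⟩
    k * (k ^ k * (y + S) ^ suc k) + k * p ^ suc k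
  ∎))
  where
  open ≤-Reasoning
  p = suc k * S
  q = k * (y + S)
  tangent-form : ∀ k y S U V → k * ((1 + k) * U * (y * V)) + k * ((1 + k) * S * (U * V))
                             ≡ (1 + k) * (U * V * (k * (y + S)))
  tangent-form = solve-∀

n^n≢0 : ∀ n → NonZero (n ^ n)
n^n≢0 zero    = _
n^n≢0 (suc n) = m^n≢0 (suc n) (suc n)

amgm : ∀ k (g : Fin k → ℕ) → k ^ k * product g ≤ sum g ^ k
amgm zero    g = ≤-refl
amgm (suc k) g = *-cancelˡ-≤ (k ^ k) {{n^n≢0 k}} (begin
    k ^ k * (suc k ^ suc k * (g zero * product (g ∘ suc)))
  ≡⟨ reassoc (k ^ k) (suc k ^ suc k) (g zero) (product (g ∘ suc)) ⟩
    suc k ^ suc k * (g zero * (k ^ k * product (g ∘ suc)))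
  ≤⟨ *-monoʳ-≤ (suc k ^ suc k) (*-monoʳ-≤ (g zero) (amgm k (g ∘ suc))) ⟩
    suc k ^ suc k * (g zero * sum (g ∘ suc) ^ k)
  ≤⟨ amgm-step k (g zero) (sum (g ∘ suc)) ⟩
    k ^ k * (g zero + sum (g ∘ suc)) ^ suc k
  ∎)
  where
  open ≤-Reasoning
  reassoc : ∀ a b c d → a * (b * (c * d)) ≡ b * (c * (a * d))
  reassoc = solve-∀

sum-const : ∀ k c → ∑[ i < k ] c ≡ k * c
sum-const zero    c = refl
sum-const (suc k) c = cong (c +_) (sum-const k c)

product-const : ∀ k c → product {k} (λ _ → c) ≡ c ^ k
product-const zero    c = refl
product-const (suc k) c = cong (c *_) (product-const k c)

sum-mono-≤ : ∀ {k} {g h : Fin k → ℕ} → (∀ i → g i ≤ h i) → sum g ≤ sum h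
sum-mono-≤ {zero}  g≤h = ≤-refl
sum-mono-≤ {suc k} g≤h = +-mono-≤ (g≤h zero) (sum-mono-≤ (g≤h ∘ suc))

product-nonZero : ∀ {k} {h : Fin k → ℕ} → (∀ i → NonZero (h i)) → NonZero (product h)
product-nonZero {zero}  h≢0 = _
product-nonZero {suc k} h≢0 = m*n≢0 _ _ {{h≢0 zero}} {{product-nonZero (h≢0 ∘ suc)}}

sum-indicator : ∀ {A} (b : Fin A) (h : Fin A → ℕ) → ∑[ a < A ] (if does (b ≟ a) then h a else 0) ≡ h b
sum-indicator {suc A} zero    h = trans (cong (h zero +_) (sum-replicate-zero A)) (+-identityʳ (h zero))
sum-indicator {suc A} (suc b) h = sum-indicator b (h ∘ suc)

product-except : ∀ {A} (b : Fin A) (h : Fin A → ℕ) →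
                 product (λ a → if does (b ≟ a) then 1 else h a) * h b ≡ product h
product-except {suc A} zero    h =
  trans (cong (_* h zero) (*-identityˡ (product (h ∘ suc)))) (*-comm _ (h zero))
product-except {suc A} (suc b) h =
  trans (*-assoc (h zero) _ _) (cong (h zero *_) (product-except b (h ∘ suc)))

fibreMass : ∀ {m A} → (Fin m → Fin A) → (Fin m → ℕ) → Fin A → ℕ
fibreMass {m} φ g a = ∑[ x < m ] (if does (φ x ≟ a) then g x else 0)

module _ {m A : ℕ} (φ : Fin m → Fin A) where

  sum-pushforward : ∀ g (w : Fin A → ℕ) → ∑[ x < m ] (g x * w (φ x)) ≡ ∑[ a < A ] (fibreMass φ g a * w a)
  sum-pushforward g w = begin
      ∑[ x < m ] (g x * w (φ x))
    ≡⟨ sum-cong-≗ (λ x → sum-indicator (φ x) (λ a → g x * w a)) ⟨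
      ∑[ x < m ] ∑[ a < A ] (if does (φ x ≟ a) then g x * w a else 0)
    ≡⟨ ∑-comm {m} {A} _ ⟩
      ∑[ a < A ] ∑[ x < m ] (if does (φ x ≟ a) then g x * w a else 0)
    ≡⟨ sum-cong-≗ (λ a → trans (*-distribʳ-sum {m} (w a) _)
                               (sum-cong-≗ (λ x → if-float (_* w a) (does (φ x ≟ a)) {g x} {0}))) ⟨
      ∑[ a < A ] (fibreMass φ g a * w a)
    ∎
    where open ≡-Reasoning

  fibreMass-≥ : ∀ g x → g x ≤ fibreMass φ g (φ x)
  fibreMass-≥ g x = begin
      g x                                                ≡⟨ sum-indicator x g ⟨
      ∑[ y < m ] (if does (x ≟ y) then g y else 0)       ≤⟨ sum-mono-≤ same-point⇒same-fibre ⟩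
      ∑[ y < m ] (if does (φ y ≟ φ x) then g y else 0)   ∎
    where
    open ≤-Reasoning
    same-point⇒same-fibre : ∀ y → (if does (x ≟ y) then g y else 0)
                                ≤ (if does (φ y ≟ φ x) then g y else 0)
    same-point⇒same-fibre y with x ≟ y
    ... | no _     = z≤n
    ... | yes refl with φ x ≟ φ x
    ...   | yes _   = ≤-refl
    ...   | no φx≢φx = contradiction refl φx≢φx

  -- AM-GM for the ratios g x / M (φ x), cleared of denominators by Q = ∏ₐ (M a ⊔ 1); the ⊔ 1
  -- keeps empty fibres from making Q zero.
  amgm-fibres : ∀ g → (∀ x → 0 < g x) → m ^ m * product g ≤ A ^ m * product (fibreMass φ g ∘ φ)
  amgm-fibres g g>0 = *-cancelˡ-≤ R {{R≢0}} (begin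
      R * (m ^ m * product g)         ≡⟨ swap R (m ^ m) (product g) ⟩
      m ^ m * (R * product g)         ≡⟨ cong (m ^ m *_) (*-comm R (product g)) ⟩
      m ^ m * (product g * R)         ≡⟨ cong (m ^ m *_) (product-distrib-* g (r ∘ φ)) ⟨
      m ^ m * product z               ≤⟨ amgm m z ⟩
      sum z ^ m                       ≤⟨ ^-monoˡ-≤ m sum-z≤A*Q ⟩
      (A * Q) ^ m                     ≡⟨ ^-distrib-* A Q m ⟩
      A ^ m * Q ^ m                   ≡⟨ cong (A ^ m *_) Qᵐ≡R*∏M∘φ ⟩
      A ^ m * (R * product (M ∘ φ))   ≡⟨ swap (A ^ m) R (product (M ∘ φ)) ⟩
      R * (A ^ m * product (M ∘ φ))   ∎)
    where
    open ≤-Reasoning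
    M = fibreMass φ g
    q : Fin A → ℕ
    q a = M a ⊔ 1
    Q = product q
    r : Fin A → ℕ
    r a = product (λ b → if does (a ≟ b) then 1 else q b)
    R = product (r ∘ φ)
    z : Fin m → ℕ
    z x = g x * r (φ x)

    swap : ∀ a b c → a * (b * c) ≡ b * (a * c)
    swap = solve-∀

    r*q≡Q : ∀ a → r a * q a ≡ Q
    r*q≡Q a = product-except a q

    R≢0 : NonZero R
    R≢0 = product-nonZero (λ x → m*n≢0⇒m≢0 (r (φ x)) {{subst NonZero (sym (r*q≡Q (φ x))) Q≢0}})
      where Q≢0 = product-nonZero (λ a → >-nonZero (m≤n⊔m (M a) 1))

    sum-z≤A*Q : sum z ≤ A * Q
    sum-z≤A*Q = begin
      sum z                      ≡⟨ sum-pushforward g r ⟩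
      ∑[ a < A ] (M a * r a)     ≤⟨ sum-mono-≤ (λ a → *-monoˡ-≤ (r a) (m≤m⊔n (M a) 1)) ⟩
      ∑[ a < A ] (q a * r a)     ≡⟨ sum-cong-≗ (λ a → trans (*-comm (q a) (r a)) (r*q≡Q a)) ⟩
      ∑[ a < A ] Q               ≡⟨ sum-const A Q ⟩
      A * Q                      ∎

    Qᵐ≡R*∏M∘φ : Q ^ m ≡ R * product (M ∘ φ)
    Qᵐ≡R*∏M∘φ = begin-equality
      Q ^ m                                 ≡⟨ product-const m Q ⟨
      product {m} (λ _ → Q)                 ≡⟨ product-cong-≗ (λ x → r*q≡Q (φ x)) ⟨
      product (λ x → r (φ x) * q (φ x))     ≡⟨ product-distrib-* (r ∘ φ) (q ∘ φ) ⟩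
      R * product (q ∘ φ)                   ≡⟨ cong (R *_) (product-cong-≗ q∘φ≡M∘φ) ⟩
      R * product (M ∘ φ)                   ∎
      where
      q∘φ≡M∘φ : ∀ x → q (φ x) ≡ M (φ x)
      q∘φ≡M∘φ x = m≥n⇒m⊔n≡m (≤-trans (g>0 x) (fibreMass-≥ g x))

chainsFrom : (n m : ℕ) (a : Fin n → ℕ) (f : (i : Fin n) → Fin m → Fin (a i)) → Fin m → ℕ
chainsFrom zero    m a f x = 1
chainsFrom (suc n) m a f x = fibreMass (f zero) (chainsFrom n m (a ∘ suc) (f ∘ suc)) (f zero x)

length-filter-map : ∀ {A B : Set} {P : Pred B 0ℓ} (P? : Decidable P) (h : A → B) xs →
                    length (filter P? (map h xs)) ≡ length (filter (P? ∘ h) xs)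
length-filter-map P? h []       = refl
length-filter-map P? h (x ∷ xs) with does (P? (h x))
... | true  = cong suc (length-filter-map P? h xs)
... | false = length-filter-map P? h xs

length-filter-concatMap-allFinL : ∀ m {B : Set} {P : Pred B 0ℓ} (P? : Decidable P) (g : Fin m → List B) →
  length (filter P? (concatMap g (allFinL m))) ≡ ∑[ x < m ] length (filter P? (g x))
length-filter-concatMap-allFinL zero    P? g = refl
length-filter-concatMap-allFinL (suc m) P? g = begin
    length (filter P? (g zero ++ concatMap g (map suc (allFinL m))))
  ≡⟨ cong length (filter-++ P? (g zero) _) ⟩
    length (filter P? (g zero) ++ filter P? (concatMap g (map suc (allFinL m))))
  ≡⟨ length-++ (filter P? (g zero)) ⟩
    length (filter P? (g zero)) + length (filter P? (concatMap g (map suc (allFinL m))))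
  ≡⟨ cong (λ ys → length (filter P? (g zero)) + length (filter P? ys)) (concatMap-map g suc (allFinL m)) ⟩
    length (filter P? (g zero)) + length (filter P? (concatMap (g ∘ suc) (allFinL m)))
  ≡⟨ cong (length (filter P? (g zero)) +_) (length-filter-concatMap-allFinL m P? (g ∘ suc)) ⟩
    ∑[ x < suc m ] length (filter P? (g x))
  ∎
  where open ≡-Reasoning

countTuples-suc : ∀ k m {P} (P? : Decidable P) →
                  countTuples (suc k) m P? ≡ ∑[ x < m ] countTuples k m (λ t → P? (x ∷ t))
countTuples-suc k m P? = trans (length-filter-concatMap-allFinL m P? _)
                               (sum-cong-≗ (λ x → length-filter-map P? (x ∷_) (allTuples k m)))

countTuples-chain-cons : ∀ n m a f x y →
  countTuples n m (λ t → chain? (suc n) m a f (x ∷ y ∷ t))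
  ≡ (if does (f zero y ≟ f zero x) then countTuples n m (λ t → chain? n m (a ∘ suc) (f ∘ suc) (y ∷ t)) else 0)
countTuples-chain-cons n m a f x y with f zero y ≟ f zero x
... | yes fy≡fx = cong length (filter-≐ _ _ ((λ c → c ∘ suc) , extend) (allTuples n m))
  where
  extend : ∀ {t} → Chain n m (a ∘ suc) (f ∘ suc) (y ∷ t) → Chain (suc n) m a f (x ∷ y ∷ t)
  extend c zero    = sym fy≡fx
  extend c (suc i) = c i
... | no fy≢fx = cong length (filter-none _ (All.universal (λ t c → fy≢fx (sym (c zero))) (allTuples n m)))

countTuples-chain : ∀ n m a f x → countTuples n m (λ t → chain? n m a f (x ∷ t)) ≡ chainsFrom n m a f x
countTuples-chain zero    m a f x = refl
countTuples-chain (suc n) m a f x = begin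
    countTuples (suc n) m (λ t → chain? (suc n) m a f (x ∷ t))
  ≡⟨ countTuples-suc n m _ ⟩
    ∑[ y < m ] countTuples n m (λ t → chain? (suc n) m a f (x ∷ y ∷ t))
  ≡⟨ sum-cong-≗ (λ y → trans (countTuples-chain-cons n m a f x y)
                             (cong (λ c → if does (f zero y ≟ f zero x) then c else 0)
                                   (countTuples-chain n m (a ∘ suc) (f ∘ suc) y))) ⟩
    chainsFrom (suc n) m a f x
  ∎
  where open ≡-Reasoning

chainCount≡sum-chainsFrom : ∀ n m a f → chainCount n m a f ≡ sum (chainsFrom n m a f)
chainCount≡sum-chainsFrom n m a f =
  trans (countTuples-suc n m (chain? n m a f)) (sum-cong-≗ (countTuples-chain n m a f))

chainsFrom-positive : ∀ n m a f x → 0 < chainsFrom n m a f x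
chainsFrom-positive zero    m a f x = s≤s z≤n
chainsFrom-positive (suc n) m a f x =
  ≤-trans (chainsFrom-positive n m (a ∘ suc) (f ∘ suc) x) (fibreMass-≥ (f zero) _ x)

product-chainsFrom-≥ : ∀ n m a f → m ^ (n * m) ≤ product (chainsFrom n m a f) * prodFin n a ^ m
product-chainsFrom-≥ zero    m a f =
  ≤-reflexive (sym (cong₂ _*_ (trans (product-const m 1) (^-zeroˡ m)) (^-zeroˡ m)))
product-chainsFrom-≥ (suc n) m a f = begin
    m ^ (m + n * m)                       ≡⟨ ^-distribˡ-+-* m m (n * m) ⟩
    m ^ m * m ^ (n * m)                   ≤⟨ *-monoʳ-≤ (m ^ m) (product-chainsFrom-≥ n m (a ∘ suc) (f ∘ suc)) ⟩
    m ^ m * (product c * P ^ m)           ≡⟨ *-assoc (m ^ m) (product c) (P ^ m) ⟨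
    m ^ m * product c * P ^ m             ≤⟨ *-monoˡ-≤ (P ^ m) (amgm-fibres (f zero) c c>0) ⟩
    a zero ^ m * product c′ * P ^ m       ≡⟨ rearrange (a zero ^ m) (product c′) (P ^ m) ⟩
    product c′ * (a zero ^ m * P ^ m)     ≡⟨ cong (product c′ *_) (^-distrib-* (a zero) P m) ⟨
    product c′ * (a zero * P) ^ m         ∎
  where
  open ≤-Reasoning
  c  = chainsFrom n m (a ∘ suc) (f ∘ suc)
  c′ = chainsFrom (suc n) m a f
  P  = prodFin n (a ∘ suc)
  c>0 = chainsFrom-positive n m (a ∘ suc) (f ∘ suc)
  rearrange : ∀ x y z → x * y * z ≡ y * (x * z)
  rearrange = solve-∀

^-cancelʳ-≤ : ∀ n .{{_ : NonZero n}} {x y} → x ^ n ≤ y ^ n → x ≤ y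
^-cancelʳ-≤ n xⁿ≤yⁿ = ≮⇒≥ (λ y<x → <⇒≱ (^-monoˡ-< n y<x) xⁿ≤yⁿ)

mainTheorem2 : (n m : ℕ) (a : Fin n → ℕ) → (∀ i → a i > 0)
    → (f : (i : Fin n) → Fin m → Fin (a i))
    → m ^ suc n ≤ chainCount n m a f * prodFin n a
mainTheorem2 n zero       a _ f = z≤n
mainTheorem2 n m@(suc _)  a _ f = ^-cancelʳ-≤ m (begin
    (m ^ suc n) ^ m                  ≡⟨ ^-*-assoc m (suc n) m ⟩
    m ^ (m + n * m)                  ≡⟨ ^-distribˡ-+-* m m (n * m) ⟩
    m ^ m * m ^ (n * m)              ≤⟨ *-monoʳ-≤ (m ^ m) (product-chainsFrom-≥ n m a f) ⟩
    m ^ m * (product c * P ^ m)      ≡⟨ *-assoc (m ^ m) (product c) (P ^ m) ⟨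
    m ^ m * product c * P ^ m        ≤⟨ *-monoˡ-≤ (P ^ m) (amgm m c) ⟩
    sum c ^ m * P ^ m                ≡⟨ ^-distrib-* (sum c) P m ⟨
    (sum c * P) ^ m                  ≡⟨ cong (λ N → (N * P) ^ m) (chainCount≡sum-chainsFrom n m a f) ⟨
    (chainCount n m a f * P) ^ m     ∎)
  where
  open ≤-Reasoning
  c = chainsFrom n m a f
  P = prodFin n a
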